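{- Let $\mathbf L=(L,\vee,\wedge)$ be a finite lattice with least element $0$ and greatest element $1$, and let $a\in L$ with $L=[0,a]\cup[a,1]$. Then \[|P_{\{a\}}(\mathbf L)|=|\{(x,y)\in L^2\mid x,y<a;\ x\vee y=a\}|-1+|\{(x,y)\in L^2\mid x,y>a;\ x\wedge y=a\}|+2\,|[0,a]|\cdot|[a,1]|.\]
   Context: For a lattice $\mathbf L$ and $S\subseteq L$, $P_S(\mathbf L):=\{(x,y)\in L^2\mid x\wedge y\leq z\leq x\vee y\text{ for all }z\in S\}$. $[c,d]$ denotes the interval $\{x\in L\mid c\leq x\leq d\}$. -}

module Defs where

open import Level using (Level; _⊔_)
open import Data.Nat using (ℕ)
open import Data.Fin using (Fin)
open import Data.Product using (Σ; _×_; _,_; proj₁)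
open import Relation.Nullary using (¬_)
open import Relation.Binary using (Setoid)
import Relation.Binary.Construct.On as On
open import Relation.Binary.PropositionalEquality using () renaming (setoid to ≡-setoid)
open import Data.Product.Relation.Binary.Pointwise.NonDependent using (×-setoid)
open import Function.Bundles using (Inverse)
open import Relation.Binary.Lattice.Bundles using (BoundedLattice)

SubSetoid : ∀ {a ℓ p} (S : Setoid a ℓ) → (Setoid.Carrier S → Set p) → Setoid (a ⊔ p) ℓ
SubSetoid S P = On.setoid {B = Σ (Setoid.Carrier S) P} S proj₁

HasSize : ∀ {a ℓ} → Setoid a ℓ → ℕ → Set (a ⊔ ℓ)
HasSize S k = Inverse S (≡-setoid (Fin k))

module _ {c ℓ₁ ℓ₂} (L : BoundedLattice c ℓ₁ ℓ₂) where
  open BoundedLattice L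

  _<ᴸ_ : Carrier → Carrier → Set (ℓ₁ ⊔ ℓ₂)
  x <ᴸ y = (x ≤ y) × ¬ (x ≈ y)

  L² : Setoid c ℓ₁
  L² = ×-setoid setoid setoid

  Interval : Carrier → Carrier → Setoid (c ⊔ ℓ₂) ℓ₁
  Interval lo hi = SubSetoid setoid (λ x → (lo ≤ x) × (x ≤ hi))

  -- P_{a}(L) = {(x,y) ∈ L² | x ∧ y ≤ a ≤ x ∨ y}  (i.e. P_S with S = {a})
  P-single : Carrier → Setoid (c ⊔ ℓ₂) ℓ₁
  P-single a = SubSetoid L² (λ { (x , y) → (x ∧ y ≤ a) × (a ≤ x ∨ y) })

  BelowJoin : Carrier → Setoid (c ⊔ ℓ₁ ⊔ ℓ₂) ℓ₁
  BelowJoin a = SubSetoid L² (λ { (x , y) → (x <ᴸ a) × (y <ᴸ a) × (x ∨ y ≈ a) })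

  AboveMeet : Carrier → Setoid (c ⊔ ℓ₁ ⊔ ℓ₂) ℓ₁
  AboveMeet a = SubSetoid L² (λ { (x , y) → (a <ᴸ x) × (a <ᴸ y) × (x ∧ y ≈ a) })

{-# OPTIONS --safe #-}
-- Every set in the statement is counted as a sum of 0/1 indicators over L², so it
-- suffices to show, for each pair (x , y), that
--   [x ∧ y ≤ a ≤ x ∨ y] + [x = y = a]
--     = [x , y < a , x ∨ y = a] + [a < x , y , x ∧ y = a] + [x ≤ a ≤ y] + [y ≤ a ≤ x].
-- Since every element is comparable with a, either x and y lie on opposite sides of a,
-- in which case the pair lies in P_{a} and in exactly one of the two products
-- [0 , a] × [a , 1], [a , 1] × [0 , a] except for (a , a), which lies in both; or both lie
-- strictly below a, where x ∧ y ≤ a ≤ x ∨ y just says x ∨ y = a; or dually both lie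
-- strictly above a.
module Submission where

open import Data.Bool using (Bool; true; false; T)
open import Data.Bool.Properties using (T-irrelevant)
open import Data.Fin using (Fin; zero; suc)
import Data.Fin as Fin
open import Data.Fin.Permutation using (↔⇒≡)
open import Data.Fin.Properties using (+↔⊎; *↔×)
open import Data.Nat as ℕ using (ℕ; _+_; _*_)
open import Data.Nat.Properties using (+-0-commutativeMonoid; +-comm)
open import Algebra.Properties.CommutativeMonoid.Sum +-0-commutativeMonoid
  using (sum-syntax; ∑-distrib-+; sum-cong-≗)
open import Data.Nat.Tactic.RingSolver using (solve-∀)
open import Data.Product using (Σ; _×_; _,_; proj₁; proj₂; swap)
open import Data.Product.Function.NonDependent.Setoid using (_×-inverse_)
open import Data.Product.Relation.Binary.Pointwise.NonDependent using (×-setoid; Pointwise-≡↔≡)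
import Data.Sum as Sum
open import Data.Sum using (_⊎_; inj₁; inj₂)
open import Data.Sum.Function.Propositional using (_⊎-↔_)
open import Data.Unit using (tt)
open import Function using (_∘_)
open import Function.Bundles using (Inverse; Equivalence; _⇔_; _↔_; mk↔ₛ′; mk⇔)
import Function.Construct.Composition as Compose
import Function.Construct.Symmetry as Symmetry
open import Function.Properties.Inverse using (Inverse⇒Injection)
open import Level using (Level; _⊔_)
open import Relation.Binary using (Setoid; Decidable)
open import Relation.Binary.Definitions using (_Respects_)
open import Relation.Binary.Lattice.Bundles using (BoundedLattice)
import Relation.Binary.Lattice.Properties.JoinSemilattice as JoinSemilatticeProperties
import Relation.Binary.Lattice.Properties.MeetSemilattice as MeetSemilatticeProperties
import Relation.Binary.PropositionalEquality as ≡
open import Relation.Binary.PropositionalEquality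
  using (_≡_; refl; cong; cong₂; sym; module ≡-Reasoning) renaming (setoid to ≡-setoid)
open import Relation.Nullary using (Dec; yes; no; isYes; ¬_; ¬?; _×-dec_; contradiction)
open import Relation.Nullary.Decidable using (via-injection; toWitness; fromWitness)
import Relation.Unary as U
open import Defs

private
  variable
    p : Level

indicator : Bool → ℕ
indicator true  = 1
indicator false = 0

𝟙 : ∀ {A : Set p} → Dec A → ℕ
𝟙 a? = indicator (isYes a?)

𝟙-yes : ∀ {A : Set p} (a? : Dec A) → A → 𝟙 a? ≡ 1
𝟙-yes (yes _) _ = refl
𝟙-yes (no ¬a) a = contradiction a ¬a

𝟙-no : ∀ {A : Set p} (a? : Dec A) → ¬ A → 𝟙 a? ≡ 0
𝟙-no (yes a) ¬a = contradiction a ¬a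
𝟙-no (no _)  _  = refl

𝟙-⇔ : ∀ {q} {A : Set p} {B : Set q} → A ⇔ B → (a? : Dec A) (b? : Dec B) → 𝟙 a? ≡ 𝟙 b?
𝟙-⇔ A⇔B (yes a)  b? = sym (𝟙-yes b? (Equivalence.to A⇔B a))
𝟙-⇔ A⇔B (no ¬a) b? = sym (𝟙-no b? (¬a ∘ Equivalence.from A⇔B))

T↔Fin-indicator : ∀ b → T b ↔ Fin (indicator b)
T↔Fin-indicator true  = mk↔ₛ′ (λ _ → zero) (λ _ → tt) (λ { zero → refl ; (suc ()) }) (λ _ → refl)
T↔Fin-indicator false = mk↔ₛ′ (λ ()) (λ ()) (λ ()) (λ ())

Σ-Fin-suc↔⊎ : ∀ {N} (B : Fin (ℕ.suc N) → Set p) → Σ (Fin (ℕ.suc N)) B ↔ (B zero ⊎ Σ (Fin N) (B ∘ suc))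
Σ-Fin-suc↔⊎ {N = N} B = mk↔ₛ′ split join
  (λ { (inj₁ _) → refl ; (inj₂ _) → refl }) (λ { (zero , _) → refl ; (suc _ , _) → refl })
  where
  split : Σ (Fin (ℕ.suc N)) B → B zero ⊎ Σ (Fin N) (B ∘ suc)
  split (zero  , b) = inj₁ b
  split (suc i , b) = inj₂ (i , b)
  join : B zero ⊎ Σ (Fin N) (B ∘ suc) → Σ (Fin (ℕ.suc N)) B
  join (inj₁ b)       = zero , b
  join (inj₂ (i , b)) = suc i , b

Σ-T↔Fin-∑-indicator : ∀ N (b : Fin N → Bool) → Σ (Fin N) (T ∘ b) ↔ Fin (∑[ i < N ] indicator (b i))
Σ-T↔Fin-∑-indicator ℕ.zero b = mk↔ₛ′ (λ { (() , _) }) (λ ()) (λ ()) (λ { (() , _) })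
Σ-T↔Fin-∑-indicator (ℕ.suc N) b =
  Compose.inverse (Σ-Fin-suc↔⊎ (T ∘ b))
    (Compose.inverse (T↔Fin-indicator (b zero) ⊎-↔ Σ-T↔Fin-∑-indicator N (b ∘ suc)) (Symmetry.inverse +↔⊎))

HasSize-× : ∀ {a ℓ a′ ℓ′} {S : Setoid a ℓ} {S′ : Setoid a′ ℓ′} {m n} →
            HasSize S m → HasSize S′ n → HasSize (×-setoid S S′) (m * n)
HasSize-× S-size S′-size =
  Compose.inverse (S-size ×-inverse S′-size) (Compose.inverse Pointwise-≡↔≡ (Symmetry.inverse *↔×))

module FiniteSetoid {a ℓ} {S : Setoid a ℓ} {N : ℕ} (S-size : HasSize S N) where
  open Setoid S using (Carrier; _≈_) renaming (refl to ≈-refl; sym to ≈-sym)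
  open Inverse S-size using (from; inverseʳ)

  _≟_ : Decidable _≈_
  _≟_ = via-injection (Inverse⇒Injection S-size) Fin._≟_

  ∑ₛ : (Carrier → ℕ) → ℕ
  ∑ₛ f = ∑[ i < N ] f (from i)

  ∑ₛ-distrib-+ : ∀ f g → ∑ₛ (λ x → f x + g x) ≡ ∑ₛ f + ∑ₛ g
  ∑ₛ-distrib-+ f g = ∑-distrib-+ (f ∘ from) (g ∘ from)

  ∑ₛ-cong : ∀ {f g} → (∀ x → f x ≡ g x) → ∑ₛ f ≡ ∑ₛ g
  ∑ₛ-cong f≗g = sum-cong-≗ (f≗g ∘ from)

  count : {Q : U.Pred Carrier p} → U.Decidable Q → ℕ
  count Q? = ∑ₛ (𝟙 ∘ Q?)

  module _ {Q : U.Pred Carrier p} (Q-resp : Q Respects _≈_) (Q? : U.Decidable Q) where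

    -- isYes rather than does: toWitness and fromWitness are stated for it.
    private
      Index : Set
      Index = Σ (Fin N) (λ i → T (isYes (Q? (from i))))

      index-≡ : ∀ {i j} → i ≡ j → (t : T (isYes (Q? (from i)))) (t′ : T (isYes (Q? (from j)))) →
                _≡_ {A = Index} (i , t) (j , t′)
      index-≡ refl t t′ = cong (_ ,_) (T-irrelevant t t′)

      SubSetoid↔Index : Inverse (SubSetoid S Q) (≡-setoid Index)
      SubSetoid↔Index = record
        { to        = λ { (x , q) → to x , fromWitness (Q-resp (≈-sym (inverseʳ refl)) q) }
        ; from      = λ { (i , t) → from i , toWitness t }
        ; to-cong   = λ x≈y → index-≡ (to-cong x≈y) _ _
        ; from-cong = λ { refl → ≈-refl }
        ; inverse   = (λ i≡ → index-≡ (inverseˡ i≡) _ _) , (λ { refl → inverseʳ refl })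
        }
        where open Inverse S-size using (to; to-cong; inverseˡ)

    size≡count : ∀ {k} → HasSize (SubSetoid S Q) k → k ≡ count Q?
    size≡count Q-size = ↔⇒≡
      (Compose.inverse (Symmetry.inverse Q-size)
        (Compose.inverse SubSetoid↔Index (Σ-T↔Fin-∑-indicator N (λ i → isYes (Q? (from i))))))

module PairDecomposition {c ℓ₁ ℓ₂} (L : BoundedLattice c ℓ₁ ℓ₂) (a : BoundedLattice.Carrier L) where
  open BoundedLattice L
  open JoinSemilatticeProperties joinSemilattice using (∨-cong)
  open MeetSemilatticeProperties meetSemilattice using (∧-cong)

  infix 4 _<_ _≈₂_

  _<_ : Carrier → Carrier → Set (ℓ₁ ⊔ ℓ₂)
  _<_ = _<ᴸ_ L

  _≈₂_ : Carrier × Carrier → Carrier × Carrier → Set ℓ₁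
  _≈₂_ = Setoid._≈_ (L² L)

  Straddles BelowAbove AboveBelow : Carrier × Carrier → Set ℓ₂
  Straddles  (x , y) = (x ∧ y ≤ a) × (a ≤ x ∨ y)
  BelowAbove (x , y) = ((⊥ ≤ x) × (x ≤ a)) × ((a ≤ y) × (y ≤ ⊤))
  AboveBelow (x , y) = ((a ≤ x) × (x ≤ ⊤)) × ((⊥ ≤ y) × (y ≤ a))

  BothAt : Carrier × Carrier → Set ℓ₁
  BothAt (x , y) = (x ≈ a) × (y ≈ a)

  JoinBelow MeetAbove : Carrier × Carrier → Set (ℓ₁ ⊔ ℓ₂)
  JoinBelow (x , y) = (x < a) × (y < a) × (x ∨ y ≈ a)
  MeetAbove (x , y) = (a < x) × (a < y) × (x ∧ y ≈ a)

  <-respˡ-≈ : ∀ {x x′ y} → x ≈ x′ → x < y → x′ < y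
  <-respˡ-≈ x≈x′ (x≤y , x≉y) = ≤-respˡ-≈ x≈x′ x≤y , x≉y ∘ Eq.trans x≈x′

  <-respʳ-≈ : ∀ {x y y′} → y ≈ y′ → x < y → x < y′
  <-respʳ-≈ y≈y′ (x≤y , x≉y) = ≤-respʳ-≈ y≈y′ x≤y , λ x≈y′ → x≉y (Eq.trans x≈y′ (Eq.sym y≈y′))

  straddles-resp : Straddles Respects _≈₂_
  straddles-resp (x≈ , y≈) (meet≤a , a≤join) = ≤-respˡ-≈ (∧-cong x≈ y≈) meet≤a , ≤-respʳ-≈ (∨-cong x≈ y≈) a≤join

  bothAt-resp : BothAt Respects _≈₂_
  bothAt-resp (x≈ , y≈) (x≈a , y≈a) = Eq.trans (Eq.sym x≈) x≈a , Eq.trans (Eq.sym y≈) y≈a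

  joinBelow-resp : JoinBelow Respects _≈₂_
  joinBelow-resp (x≈ , y≈) (x<a , y<a , join≈a) =
    <-respˡ-≈ x≈ x<a , <-respˡ-≈ y≈ y<a , Eq.trans (Eq.sym (∨-cong x≈ y≈)) join≈a

  meetAbove-resp : MeetAbove Respects _≈₂_
  meetAbove-resp (x≈ , y≈) (a<x , a<y , meet≈a) =
    <-respʳ-≈ x≈ a<x , <-respʳ-≈ y≈ a<y , Eq.trans (Eq.sym (∧-cong x≈ y≈)) meet≈a

  belowAbove-resp : BelowAbove Respects _≈₂_
  belowAbove-resp (x≈ , y≈) ((⊥≤x , x≤a) , (a≤y , y≤⊤)) =
    (≤-respʳ-≈ x≈ ⊥≤x , ≤-respˡ-≈ x≈ x≤a) , (≤-respʳ-≈ y≈ a≤y , ≤-respˡ-≈ y≈ y≤⊤)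

  aboveBelow-resp : AboveBelow Respects _≈₂_
  aboveBelow-resp (x≈ , y≈) ((a≤x , x≤⊤) , (⊥≤y , y≤a)) =
    (≤-respʳ-≈ x≈ a≤x , ≤-respˡ-≈ x≈ x≤⊤) , (≤-respʳ-≈ y≈ ⊥≤y , ≤-respˡ-≈ y≈ y≤a)

  module Decisions (_≟_ : Decidable _≈_) where
    open JoinSemilatticeProperties joinSemilattice using (≈-dec⇒≤-dec)

    infix 4 _≤?_ _<?_

    _≤?_ : Decidable _≤_
    _≤?_ = ≈-dec⇒≤-dec _≟_

    _<?_ : Decidable _<_
    x <? y = (x ≤? y) ×-dec ¬? (x ≟ y)

    straddles? : U.Decidable Straddles
    straddles? (x , y) = (x ∧ y ≤? a) ×-dec (a ≤? x ∨ y)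

    bothAt? : U.Decidable BothAt
    bothAt? (x , y) = (x ≟ a) ×-dec (y ≟ a)

    joinBelow? : U.Decidable JoinBelow
    joinBelow? (x , y) = (x <? a) ×-dec (y <? a) ×-dec ((x ∨ y) ≟ a)

    meetAbove? : U.Decidable MeetAbove
    meetAbove? (x , y) = (a <? x) ×-dec (a <? y) ×-dec ((x ∧ y) ≟ a)

    belowAbove? : U.Decidable BelowAbove
    belowAbove? (x , y) = ((⊥ ≤? x) ×-dec (x ≤? a)) ×-dec ((a ≤? y) ×-dec (y ≤? ⊤))

    aboveBelow? : U.Decidable AboveBelow
    aboveBelow? (x , y) = ((a ≤? x) ×-dec (x ≤? ⊤)) ×-dec ((⊥ ≤? y) ×-dec (y ≤? a))

    IndicatorIdentity : Carrier × Carrier → Set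
    IndicatorIdentity z = 𝟙 (straddles? z) + 𝟙 (bothAt? z)
                        ≡ 𝟙 (joinBelow? z) + (𝟙 (meetAbove? z) + (𝟙 (belowAbove? z) + 𝟙 (aboveBelow? z)))

    indicatorIdentity-below-above : ∀ {x y} → x ≤ a → a ≤ y → IndicatorIdentity (x , y)
    indicatorIdentity-below-above {x} {y} x≤a a≤y
      rewrite 𝟙-yes (straddles? (x , y)) (trans (x∧y≤x x y) x≤a , trans a≤y (y≤x∨y x y))
            | 𝟙-no (joinBelow? (x , y)) (λ (_ , (y≤a , y≉a) , _) → y≉a (antisym y≤a a≤y))
            | 𝟙-no (meetAbove? (x , y)) (λ ((a≤x , a≉x) , _) → a≉x (antisym a≤x x≤a))
            | 𝟙-yes (belowAbove? (x , y)) ((minimum x , x≤a) , (a≤y , maximum y))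
            = cong ℕ.suc (𝟙-⇔ (mk⇔ at⇒aboveBelow aboveBelow⇒at) (bothAt? (x , y)) (aboveBelow? (x , y)))
      where
      at⇒aboveBelow : BothAt (x , y) → AboveBelow (x , y)
      at⇒aboveBelow (x≈a , y≈a) = (reflexive (Eq.sym x≈a) , maximum x) , (minimum y , reflexive y≈a)
      aboveBelow⇒at : AboveBelow (x , y) → BothAt (x , y)
      aboveBelow⇒at ((a≤x , _) , (_ , y≤a)) = antisym x≤a a≤x , antisym y≤a a≤y

    indicatorIdentity-above-below : ∀ {x y} → a ≤ x → y ≤ a → IndicatorIdentity (x , y)
    indicatorIdentity-above-below {x} {y} a≤x y≤a
      rewrite 𝟙-yes (straddles? (x , y)) (trans (x∧y≤y x y) y≤a , trans a≤x (x≤x∨y x y))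
            | 𝟙-no (joinBelow? (x , y)) (λ ((x≤a , x≉a) , _) → x≉a (antisym x≤a a≤x))
            | 𝟙-no (meetAbove? (x , y)) (λ (_ , (a≤y , a≉y) , _) → a≉y (antisym a≤y y≤a))
            | 𝟙-yes (aboveBelow? (x , y)) ((a≤x , maximum x) , (minimum y , y≤a))
            = ≡.trans (cong ℕ.suc (𝟙-⇔ (mk⇔ at⇒belowAbove belowAbove⇒at) (bothAt? (x , y)) (belowAbove? (x , y))))
                    (+-comm 1 (𝟙 (belowAbove? (x , y))))
      where
      at⇒belowAbove : BothAt (x , y) → BelowAbove (x , y)
      at⇒belowAbove (x≈a , y≈a) = (minimum x , reflexive x≈a) , (reflexive (Eq.sym y≈a) , maximum y)
      belowAbove⇒at : BelowAbove (x , y) → BothAt (x , y)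
      belowAbove⇒at ((_ , x≤a) , (a≤y , _)) = antisym x≤a a≤x , antisym y≤a a≤y

    indicatorIdentity-below-below : ∀ {x y} → x ≤ a → y ≤ a → ¬ a ≤ x → ¬ a ≤ y → IndicatorIdentity (x , y)
    indicatorIdentity-below-below {x} {y} x≤a y≤a a≰x a≰y
      rewrite 𝟙-no (bothAt? (x , y)) (λ (x≈a , _) → a≰x (reflexive (Eq.sym x≈a)))
            | 𝟙-no (meetAbove? (x , y)) (λ ((a≤x , _) , _) → a≰x a≤x)
            | 𝟙-no (belowAbove? (x , y)) (λ (_ , (a≤y , _)) → a≰y a≤y)
            | 𝟙-no (aboveBelow? (x , y)) (λ ((a≤x , _) , _) → a≰x a≤x)
            = cong (_+ 0) (𝟙-⇔ (mk⇔ straddles⇒joinBelow joinBelow⇒straddles) (straddles? (x , y)) (joinBelow? (x , y)))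
      where
      straddles⇒joinBelow : Straddles (x , y) → JoinBelow (x , y)
      straddles⇒joinBelow (_ , a≤join) =
        (x≤a , a≰x ∘ reflexive ∘ Eq.sym) , (y≤a , a≰y ∘ reflexive ∘ Eq.sym) , antisym (∨-least x≤a y≤a) a≤join
      joinBelow⇒straddles : JoinBelow (x , y) → Straddles (x , y)
      joinBelow⇒straddles (_ , _ , join≈a) = trans (x∧y≤x x y) x≤a , reflexive (Eq.sym join≈a)

    indicatorIdentity-above-above : ∀ {x y} → a ≤ x → a ≤ y → ¬ x ≤ a → ¬ y ≤ a → IndicatorIdentity (x , y)
    indicatorIdentity-above-above {x} {y} a≤x a≤y x≰a y≰a
      rewrite 𝟙-no (bothAt? (x , y)) (λ (x≈a , _) → x≰a (reflexive x≈a))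
            | 𝟙-no (joinBelow? (x , y)) (λ ((x≤a , _) , _) → x≰a x≤a)
            | 𝟙-no (belowAbove? (x , y)) (λ ((_ , x≤a) , _) → x≰a x≤a)
            | 𝟙-no (aboveBelow? (x , y)) (λ (_ , (_ , y≤a)) → y≰a y≤a)
            = cong (_+ 0) (𝟙-⇔ (mk⇔ straddles⇒meetAbove meetAbove⇒straddles) (straddles? (x , y)) (meetAbove? (x , y)))
      where
      straddles⇒meetAbove : Straddles (x , y) → MeetAbove (x , y)
      straddles⇒meetAbove (meet≤a , _) =
        (a≤x , x≰a ∘ reflexive ∘ Eq.sym) , (a≤y , y≰a ∘ reflexive ∘ Eq.sym) , antisym meet≤a (∧-greatest a≤x a≤y)
      meetAbove⇒straddles : MeetAbove (x , y) → Straddles (x , y)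
      meetAbove⇒straddles (_ , _ , meet≈a) = reflexive meet≈a , trans a≤x (x≤x∨y x y)

    indicatorIdentity : (∀ x → x ≤ a ⊎ a ≤ x) → ∀ z → IndicatorIdentity z
    indicatorIdentity comparable (x , y) = byPosition (comparable x) (comparable y)
      where
      bothBelow : x ≤ a → y ≤ a → Dec (a ≤ x) → Dec (a ≤ y) → IndicatorIdentity (x , y)
      bothBelow x≤a y≤a (yes a≤x) _         = indicatorIdentity-above-below a≤x y≤a
      bothBelow x≤a y≤a (no _)    (yes a≤y) = indicatorIdentity-below-above x≤a a≤y
      bothBelow x≤a y≤a (no a≰x)  (no a≰y)  = indicatorIdentity-below-below x≤a y≤a a≰x a≰y

      bothAbove : a ≤ x → a ≤ y → Dec (x ≤ a) → Dec (y ≤ a) → IndicatorIdentity (x , y)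
      bothAbove a≤x a≤y (yes x≤a) _         = indicatorIdentity-below-above x≤a a≤y
      bothAbove a≤x a≤y (no _)    (yes y≤a) = indicatorIdentity-above-below a≤x y≤a
      bothAbove a≤x a≤y (no x≰a)  (no y≰a)  = indicatorIdentity-above-above a≤x a≤y x≰a y≰a

      byPosition : x ≤ a ⊎ a ≤ x → y ≤ a ⊎ a ≤ y → IndicatorIdentity (x , y)
      byPosition (inj₁ x≤a) (inj₂ a≤y) = indicatorIdentity-below-above x≤a a≤y
      byPosition (inj₂ a≤x) (inj₁ y≤a) = indicatorIdentity-above-below a≤x y≤a
      byPosition (inj₁ x≤a) (inj₁ y≤a) = bothBelow x≤a y≤a (a ≤? x) (a ≤? y)
      byPosition (inj₂ a≤x) (inj₂ a≤y) = bothAbove a≤x a≤y (x ≤? a) (y ≤? a)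

  bothAt-size : HasSize (SubSetoid (L² L) BothAt) 1
  bothAt-size = record
    { to        = λ _ → zero
    ; from      = λ _ → (a , a) , (Eq.refl , Eq.refl)
    ; to-cong   = λ _ → ≡.refl
    ; from-cong = λ _ → Eq.refl , Eq.refl
    ; inverse   = (λ { {zero} _ → ≡.refl }) , (λ { {_ , (x≈a , y≈a)} _ → Eq.sym x≈a , Eq.sym y≈a })
    }

  belowAbove↔Interval² : Inverse (SubSetoid (L² L) BelowAbove) (×-setoid (Interval L ⊥ a) (Interval L a ⊤))
  belowAbove↔Interval² = record
    { to        = λ { ((x , y) , (x∈ , y∈)) → (x , x∈) , (y , y∈) }
    ; from      = λ { ((x , x∈) , (y , y∈)) → (x , y) , (x∈ , y∈) }
    ; to-cong   = λ eq → eq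
    ; from-cong = λ eq → eq
    ; inverse   = (λ eq → eq) , (λ eq → eq)
    }

  aboveBelow↔Interval² : Inverse (SubSetoid (L² L) AboveBelow) (×-setoid (Interval L ⊥ a) (Interval L a ⊤))
  aboveBelow↔Interval² = record
    { to        = λ { ((x , y) , (x∈ , y∈)) → (y , y∈) , (x , x∈) }
    ; from      = λ { ((y , y∈) , (x , x∈)) → (x , y) , (x∈ , y∈) }
    ; to-cong   = swap
    ; from-cong = swap
    ; inverse   = swap , swap
    }

module _ {c ℓ₁ ℓ₂} (L : BoundedLattice c ℓ₁ ℓ₂) {n} (L-size : HasSize (BoundedLattice.setoid L) n)
         (a : BoundedLattice.Carrier L) where
  open BoundedLattice L using (Carrier; _≤_)
  open FiniteSetoid (HasSize-× L-size L-size) using (∑ₛ; ∑ₛ-distrib-+; ∑ₛ-cong; count)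
  open FiniteSetoid L-size using (_≟_)
  open PairDecomposition L a
  open Decisions _≟_

  count-decomposition : (∀ x → x ≤ a ⊎ a ≤ x) →
    count straddles? + count bothAt? ≡ count joinBelow? + (count meetAbove? + (count belowAbove? + count aboveBelow?))
  count-decomposition comparable = begin
    count straddles? + count bothAt?                      ≡⟨ sym (∑ₛ-distrib-+ (𝟙 ∘ straddles?) (𝟙 ∘ bothAt?)) ⟩
    ∑ₛ (λ z → 𝟙 (straddles? z) + 𝟙 (bothAt? z))            ≡⟨ ∑ₛ-cong (indicatorIdentity comparable) ⟩
    ∑ₛ (λ z → 𝟙 (joinBelow? z) + rest₁ z)                 ≡⟨ ∑ₛ-distrib-+ (𝟙 ∘ joinBelow?) rest₁ ⟩
    count joinBelow? + ∑ₛ rest₁                           ≡⟨ cong (count joinBelow? +_) (∑ₛ-distrib-+ (𝟙 ∘ meetAbove?) rest₂) ⟩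
    count joinBelow? + (count meetAbove? + ∑ₛ rest₂)       ≡⟨ cong (λ s → count joinBelow? + (count meetAbove? + s))
                                                                  (∑ₛ-distrib-+ (𝟙 ∘ belowAbove?) (𝟙 ∘ aboveBelow?)) ⟩
    count joinBelow? + (count meetAbove? + (count belowAbove? + count aboveBelow?)) ∎
    where
    open ≡-Reasoning
    rest₂ rest₁ : Carrier × Carrier → ℕ
    rest₂ z = 𝟙 (belowAbove? z) + 𝟙 (aboveBelow? z)
    rest₁ z = 𝟙 (meetAbove? z) + rest₂ z

lemma13 : ∀ {c ℓ₁ ℓ₂} (L : BoundedLattice c ℓ₁ ℓ₂)
            → Σ ℕ (λ n → HasSize (BoundedLattice.setoid L) n)
            → (a : BoundedLattice.Carrier L)
            → (∀ x → (BoundedLattice._≤_ L (BoundedLattice.⊥ L) x × BoundedLattice._≤_ L x a)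
                     ⊎ (BoundedLattice._≤_ L a x × BoundedLattice._≤_ L x (BoundedLattice.⊤ L)))
            → (p k₁ k₂ m₁ m₂ : ℕ)
            → HasSize (P-single L a) p
            → HasSize (BelowJoin L a) k₁
            → HasSize (AboveMeet L a) k₂
            → HasSize (Interval L (BoundedLattice.⊥ L) a) m₁
            → HasSize (Interval L a (BoundedLattice.⊤ L)) m₂
            → p + 1 ≡ k₁ + k₂ + 2 * m₁ * m₂
lemma13 L (n , L-size) a split p k₁ k₂ m₁ m₂ P-size BJ-size AM-size I₁-size I₂-size = begin
  p + 1
    ≡⟨ cong₂ _+_ (size≡count straddles-resp straddles? P-size) (size≡count bothAt-resp bothAt? bothAt-size) ⟩
  count straddles? + count bothAt?
    ≡⟨ count-decomposition L L-size a (Sum.map proj₂ proj₁ ∘ split) ⟩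
  count joinBelow? + (count meetAbove? + (count belowAbove? + count aboveBelow?))
    ≡⟨ sym (cong₂ _+_ (size≡count joinBelow-resp joinBelow? BJ-size)
           (cong₂ _+_ (size≡count meetAbove-resp meetAbove? AM-size)
           (cong₂ _+_ (size≡count belowAbove-resp belowAbove? (Compose.inverse belowAbove↔Interval² I²-size))
                      (size≡count aboveBelow-resp aboveBelow? (Compose.inverse aboveBelow↔Interval² I²-size))))) ⟩
  k₁ + (k₂ + (m₁ * m₂ + m₁ * m₂))
    ≡⟨ rearrange k₁ k₂ m₁ m₂ ⟩
  k₁ + k₂ + 2 * m₁ * m₂ ∎
  where
  open ≡-Reasoning
  open FiniteSetoid (HasSize-× L-size L-size) using (count; size≡count)
  open PairDecomposition L a
  open Decisions (FiniteSetoid._≟_ L-size)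
  I²-size = HasSize-× I₁-size I₂-size
  rearrange : ∀ k₁ k₂ m₁ m₂ → k₁ + (k₂ + (m₁ * m₂ + m₁ * m₂)) ≡ k₁ + k₂ + 2 * m₁ * m₂
  rearrange = solve-∀
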